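{- Let $\mathbf A$ be a commutative integral residuated lattice and let $q(\vec x):=\ \&\{e_i:i\in I\}\Longrightarrow e$ be a quasi-equation in the language $\langle\land,\lor,*,\Rightarrow,1\rangle$ of residuated lattices, with $\vec x$ the variables occurring in it. Let $q^*(\vec x):=\ \&(\{e_i:i\in I\}\cup\{\neg x\sqsubseteq x: x\in\vec x\})\Longrightarrow e$, where $\neg x\sqsubseteq x$ abbreviates the equation $x\lor\neg x\approx x$. Then $\mathbf A\models q(\vec x)$ if and only if $\mathbf A^*\models q^*(\vec x)$.
   Context: A commutative integral residuated lattice (CIRL) is an algebra $\langle A,\land,\lor,*,\Rightarrow,1\rangle$ such that $\langle A,\land,\lor\rangle$ is a lattice with top element $1$, $\langle A,*,1\rangle$ is a commutative monoid, and $a*b\le c$ iff $b\le a\Rightarrow c$. Quasi-equations have finitely many premisses. Doubling: given a CIRL $\mathbf A$, let $\neg A=\{\neg a:a\in A\}$ be a disjoint copy of $A$ and $A^*=A\cup\neg A$. Order $A^*$ by: for $a,b\in A$, $a\le b$ iff $a\le_A b$; $\neg a\le b$ always; $\neg a\le\neg b$ iff $b\le_A a$ (and $a\not\le\neg b$). Set $\neg(\neg a):=a$; on $A$ the operations are those of $\mathbf A$; $\neg a\land\neg b:=\neg(a\lor b)$, $\neg a\lor\neg b:=\neg(a\land b)$ (mixed meets/joins are determined by the order); $a*\neg b=\neg b*a:=\neg(a\Rightarrow b)$, $\neg a*\neg b:=\neg1$; $a\Rightarrow\neg b:=\neg(a*b)$, $\neg a\Rightarrow\neg b:=b\Rightarrow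 a$, $\neg a\Rightarrow b:=1$; the constants are $1$ and $0:=\neg 1$. Then $\mathbf A^*=\langle A^*,\land,\lor,*,\Rightarrow,\neg,0,1\rangle$. -}

module Defs where

open import Level using (Level; _⊔_; suc; Lift)
open import Data.Empty using (⊥)
open import Data.Nat using (ℕ)
open import Data.Fin using (Fin)
open import Data.List using (List; []; _∷_; _++_; map)
open import Data.List.Relation.Unary.All using (All)
open import Data.Product using (_×_; _,_)
open import Data.Sum using (_⊎_; inj₁; inj₂)
open import Relation.Binary using (Rel; IsEquivalence)
open import Algebra.Lattice.Structures using (IsLattice)
open import Algebra.Structures using (IsCommutativeMonoid)

record CIRL (c ℓ : Level) : Set (suc (c ⊔ ℓ)) where
  infix  4 _≈_ _≤_
  infixr 5 _⇒_
  infixr 6 _∨_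
  infixr 7 _∧_
  infixr 8 _*_
  field
    Carrier : Set c
    _≈_     : Rel Carrier ℓ
    _∧_     : Carrier → Carrier → Carrier
    _∨_     : Carrier → Carrier → Carrier
    _*_     : Carrier → Carrier → Carrier
    _⇒_     : Carrier → Carrier → Carrier
    one     : Carrier
  _≤_ : Rel Carrier ℓ
  x ≤ y = (x ∧ y) ≈ x
  field
    isLattice           : IsLattice _≈_ _∨_ _∧_
    top                 : ∀ x → x ≤ one
    isCommutativeMonoid : IsCommutativeMonoid _≈_ _*_ one
    ⇒-cong              : ∀ {a a' b b'} → a ≈ a' → b ≈ b' → (a ⇒ b) ≈ (a' ⇒ b')
    residuation₁        : ∀ a b c → (a * b) ≤ c → b ≤ (a ⇒ c)
    residuation₂        : ∀ a b c → b ≤ (a ⇒ c) → (a * b) ≤ c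

-- Algebras in the extended signature ⟨∧,∨,*,⇒,¬,0,1⟩ (no laws needed)

record ExtAlg (c ℓ : Level) : Set (suc (c ⊔ ℓ)) where
  field
    Carrier : Set c
    _≈_     : Rel Carrier ℓ
    _∧_     : Carrier → Carrier → Carrier
    _∨_     : Carrier → Carrier → Carrier
    _*_     : Carrier → Carrier → Carrier
    _⇒_     : Carrier → Carrier → Carrier
    ¬_      : Carrier → Carrier
    zero    : Carrier
    one     : Carrier

-- The doubling A* : inj₁ a stands for a ∈ A, inj₂ a stands for ¬a ∈ ¬A.

module _ {c ℓ} (A : CIRL c ℓ) where
  private module A = CIRL A
  private
    D = A.Carrier ⊎ A.Carrier

    meet : D → D → D
    meet (inj₁ a) (inj₁ b) = inj₁ (a A.∧ b)
    meet (inj₁ a) (inj₂ b) = inj₂ b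
    meet (inj₂ a) (inj₁ b) = inj₂ a
    meet (inj₂ a) (inj₂ b) = inj₂ (a A.∨ b)

    join : D → D → D
    join (inj₁ a) (inj₁ b) = inj₁ (a A.∨ b)
    join (inj₁ a) (inj₂ b) = inj₁ a
    join (inj₂ a) (inj₁ b) = inj₁ b
    join (inj₂ a) (inj₂ b) = inj₂ (a A.∧ b)

    mul : D → D → D
    mul (inj₁ a) (inj₁ b) = inj₁ (a A.* b)
    mul (inj₁ a) (inj₂ b) = inj₂ (a A.⇒ b)
    mul (inj₂ b) (inj₁ a) = inj₂ (a A.⇒ b)
    mul (inj₂ a) (inj₂ b) = inj₂ A.one

    imp : D → D → D
    imp (inj₁ a) (inj₁ b) = inj₁ (a A.⇒ b)
    imp (inj₁ a) (inj₂ b) = inj₂ (a A.* b)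
    imp (inj₂ a) (inj₁ b) = inj₁ A.one
    imp (inj₂ a) (inj₂ b) = inj₁ (b A.⇒ a)

    _≈D_ : D → D → Set ℓ
    inj₁ a ≈D inj₁ b = a A.≈ b
    inj₂ a ≈D inj₂ b = a A.≈ b
    inj₁ a ≈D inj₂ b = Lift ℓ ⊥
    inj₂ a ≈D inj₁ b = Lift ℓ ⊥

    neg : D → D
    neg (inj₁ a) = inj₂ a
    neg (inj₂ a) = inj₁ a

  Double : ExtAlg c ℓ
  Double = record
    { Carrier = D
    ; _≈_     = _≈D_
    ; _∧_     = meet
    ; _∨_     = join
    ; _*_     = mul
    ; _⇒_     = imp
    ; ¬_      = neg
    ; zero    = inj₂ A.one
    ; one     = inj₁ A.one
    }

data RTerm (n : ℕ) : Set where
  var          : Fin n → RTerm n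
  _∧ᵗ_ _∨ᵗ_ _*ᵗ_ _⇒ᵗ_ : RTerm n → RTerm n → RTerm n
  oneᵗ         : RTerm n

data ETerm (n : ℕ) : Set where
  var          : Fin n → ETerm n
  _∧ᵗ_ _∨ᵗ_ _*ᵗ_ _⇒ᵗ_ : ETerm n → ETerm n → ETerm n
  ¬ᵗ_          : ETerm n → ETerm n
  zeroᵗ oneᵗ   : ETerm n

embed : ∀ {n} → RTerm n → ETerm n
embed (var x)   = var x
embed (s ∧ᵗ t)  = embed s ∧ᵗ embed t
embed (s ∨ᵗ t)  = embed s ∨ᵗ embed t
embed (s *ᵗ t)  = embed s *ᵗ embed t
embed (s ⇒ᵗ t)  = embed s ⇒ᵗ embed t
embed oneᵗ      = oneᵗ

varsT : ∀ {n} → RTerm n → List (Fin n)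
varsT (var x)  = x ∷ []
varsT (s ∧ᵗ t) = varsT s ++ varsT t
varsT (s ∨ᵗ t) = varsT s ++ varsT t
varsT (s *ᵗ t) = varsT s ++ varsT t
varsT (s ⇒ᵗ t) = varsT s ++ varsT t
varsT oneᵗ     = []

record QuasiEq (T : ℕ → Set) (n : ℕ) : Set where
  constructor _⟹_
  field
    premisses  : List (T n × T n)
    conclusion : T n × T n

varsE : ∀ {n} → RTerm n × RTerm n → List (Fin n)
varsE (s , t) = varsT s ++ varsT t

varsQ : ∀ {n} → QuasiEq RTerm n → List (Fin n)
varsQ (ps ⟹ e) = concatVars ps ++ varsE e
  where
  concatVars : List (RTerm _ × RTerm _) → List (Fin _)
  concatVars []       = []
  concatVars (p ∷ ps) = varsE p ++ concatVars ps

embedE : ∀ {n} → RTerm n × RTerm n → ETerm n × ETerm n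
embedE (s , t) = embed s , embed t

star : ∀ {n} → QuasiEq RTerm n → QuasiEq ETerm n
star q@(ps ⟹ (s , t)) =
  (map embedE ps ++ map (λ x → ((var x ∨ᵗ (¬ᵗ var x)) , var x)) (varsQ q))
    ⟹ (embed s , embed t)

module _ {c ℓ} (A : CIRL c ℓ) where
  open CIRL A
  evalR : ∀ {n} → (Fin n → Carrier) → RTerm n → Carrier
  evalR ρ (var x)  = ρ x
  evalR ρ (s ∧ᵗ t) = evalR ρ s ∧ evalR ρ t
  evalR ρ (s ∨ᵗ t) = evalR ρ s ∨ evalR ρ t
  evalR ρ (s *ᵗ t) = evalR ρ s * evalR ρ t
  evalR ρ (s ⇒ᵗ t) = evalR ρ s ⇒ evalR ρ t
  evalR ρ oneᵗ     = one

  _⊨ᴿ_ : ∀ {n} → QuasiEq RTerm n → Set (c ⊔ ℓ)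
  _⊨ᴿ_ {n} (ps ⟹ (s , t)) =
    (ρ : Fin n → Carrier) →
    All (λ e → evalR ρ (Data.Product.proj₁ e) ≈ evalR ρ (Data.Product.proj₂ e)) ps →
    evalR ρ s ≈ evalR ρ t

module _ {c ℓ} (B : ExtAlg c ℓ) where
  open ExtAlg B
  evalE : ∀ {n} → (Fin n → Carrier) → ETerm n → Carrier
  evalE ρ (var x)  = ρ x
  evalE ρ (s ∧ᵗ t) = evalE ρ s ∧ evalE ρ t
  evalE ρ (s ∨ᵗ t) = evalE ρ s ∨ evalE ρ t
  evalE ρ (s *ᵗ t) = evalE ρ s * evalE ρ t
  evalE ρ (s ⇒ᵗ t) = evalE ρ s ⇒ evalE ρ t
  evalE ρ (¬ᵗ s)   = ¬ evalE ρ s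
  evalE ρ zeroᵗ    = zero
  evalE ρ oneᵗ     = one

  _⊨ᴱ_ : ∀ {n} → QuasiEq ETerm n → Set (c ⊔ ℓ)
  _⊨ᴱ_ {n} (ps ⟹ (s , t)) =
    (ρ : Fin n → Carrier) →
    All (λ e → evalE ρ (Data.Product.proj₁ e) ≈ evalE ρ (Data.Product.proj₂ e)) ps →
    evalE ρ s ≈ evalE ρ t

module Submission where

-- The doubling A* contains A as the "positive" half inj₁ A, and the operations
-- of A* restricted to inj₁ A are those of A.  The extra premisses ¬x ⊑ x of q*
-- (i.e. x ∨ ¬x ≈ x) say precisely that every variable of q is evaluated in this
-- positive half.
-- The theorem follows: a valuation of q* satisfying its premisses is positive
-- and induces a valuation of q in A; conversely every valuation σ of q in A
-- yields the positive valuation inj₁ ∘ σ of q* in A*.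

open import Defs
open import Data.Nat using (ℕ)
open import Data.Fin using (Fin)
open import Data.List using ([]; _∷_; _++_; map)
open import Data.List.Relation.Unary.All as All using (All; []; _∷_)
open import Data.List.Relation.Unary.All.Properties using (++⁻; ++⁺; map⁻; map⁺)
open import Data.Product using (_×_; _,_; proj₁; proj₂)
open import Data.Sum using (inj₁; inj₂)
open import Function using (_∘_; id)
open import Function.Bundles using (_⇔_; mk⇔; Equivalence)
open import Level using (lower)
open import Data.Empty using (⊥-elim)
open import Relation.Binary.PropositionalEquality using (_≡_; refl)
open import Relation.Binary using (IsEquivalence)
open import Algebra.Lattice.Structures using (IsLattice)

vars-split : ∀ {p} {n} {P : Fin n → Set p} ps e → All P (varsQ (ps ⟹ e)) →
             All (All P ∘ varsE) ps × All P (varsE e)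
vars-split []       e h = [] , h
vars-split (p ∷ ps) e h
  with ++⁻ (varsE p ++ _) h
... | hpps , he with ++⁻ (varsE p) hpps
... | hp , hps with vars-split ps e (++⁺ hps he)
... | hps′ , he′ = hp ∷ hps′ , he′

module _ {c ℓ} (A : CIRL c ℓ) where
  private
    module A = CIRL A
    module D = ExtAlg (Double A)

  strip : D.Carrier → A.Carrier
  strip (inj₁ a) = a
  strip (inj₂ a) = a

  negation-fixed⇒positive : ∀ d → D._∨_ d (D.¬_ d) D.≈ d → d ≡ inj₁ (strip d)
  negation-fixed⇒positive (inj₁ a) _ = refl
  negation-fixed⇒positive (inj₂ a) h = ⊥-elim (lower h)

  positive⇒negation-fixed : ∀ a → D._∨_ (inj₁ a) (D.¬_ (inj₁ a)) D.≈ inj₁ a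
  positive⇒negation-fixed a = IsEquivalence.refl (IsLattice.isEquivalence A.isLattice)

  module _ {n : ℕ} where

    Positive : (Fin n → D.Carrier) → (Fin n → A.Carrier) → Fin n → Set c
    Positive ρ σ x = ρ x ≡ inj₁ (σ x)

    HoldsD : (Fin n → D.Carrier) → ETerm n × ETerm n → Set ℓ
    HoldsD ρ e = evalE (Double A) ρ (proj₁ e) D.≈ evalE (Double A) ρ (proj₂ e)

    HoldsA : (Fin n → A.Carrier) → RTerm n × RTerm n → Set ℓ
    HoldsA σ e = evalR A σ (proj₁ e) A.≈ evalR A σ (proj₂ e)

    embed-positive : ∀ {ρ σ} t → All (Positive ρ σ) (varsT t) →
                     evalE (Double A) ρ (embed t) ≡ inj₁ (evalR A σ t)
    embed-positive (var x)  (px ∷ []) = px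
    embed-positive oneᵗ     _         = refl
    embed-positive (s ∧ᵗ t) h with ++⁻ (varsT s) h
    ... | hs , ht rewrite embed-positive s hs | embed-positive t ht = refl
    embed-positive (s ∨ᵗ t) h with ++⁻ (varsT s) h
    ... | hs , ht rewrite embed-positive s hs | embed-positive t ht = refl
    embed-positive (s *ᵗ t) h with ++⁻ (varsT s) h
    ... | hs , ht rewrite embed-positive s hs | embed-positive t ht = refl
    embed-positive (s ⇒ᵗ t) h with ++⁻ (varsT s) h
    ... | hs , ht rewrite embed-positive s hs | embed-positive t ht = refl

    equation-transfer : ∀ {ρ σ} e → All (Positive ρ σ) (varsE e) →
                        HoldsD ρ (embedE e) ⇔ HoldsA σ e
    equation-transfer (s , t) h with ++⁻ (varsT s) h
    ... | hs , ht rewrite embed-positive s hs | embed-positive t ht = mk⇔ id id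

    premisses-transfer : ∀ {ρ σ} {ps} → All (All (Positive ρ σ) ∘ varsE) ps →
                         All (HoldsD ρ ∘ embedE) ps ⇔ All (HoldsA σ) ps
    premisses-transfer pos = mk⇔
      (λ h → All.zipWith (λ {e} (p , he) → Equivalence.to (equation-transfer e p) he) (pos , h))
      (λ h → All.zipWith (λ {e} (p , he) → Equivalence.from (equation-transfer e p) he) (pos , h))

proposition7p1 : ∀ {c ℓ} (A : CIRL c ℓ) {n : ℕ} (q : QuasiEq RTerm n) →
                 (A ⊨ᴿ q) ⇔ (Double A ⊨ᴱ star q)
proposition7p1 A {n} q@(ps ⟹ e) = mk⇔ doubling-preserves doubling-reflects
  where
  open Equivalence
  negPremiss : Fin n → ETerm n × ETerm n
  negPremiss x = (var x ∨ᵗ (¬ᵗ var x)) , var x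

  -- a valuation satisfying the premisses of q* is positive, so q applies in A
  doubling-preserves : A ⊨ᴿ q → Double A ⊨ᴱ star q
  doubling-preserves hA ρ prem with ++⁻ (map embedE ps) prem
  ... | hps , hneg with vars-split ps e
        (All.map (λ {x} → negation-fixed⇒positive A (ρ x)) (map⁻ {xs = varsQ q} hneg))
  ... | posPs , posE =
    from (equation-transfer A e posE)
      (hA (strip A ∘ ρ) (to (premisses-transfer A posPs) (map⁻ hps)))

  -- a valuation σ in A gives the positive valuation inj₁ ∘ σ in A*
  doubling-reflects : Double A ⊨ᴱ star q → A ⊨ᴿ q
  doubling-reflects hD σ prem with vars-split ps e (All.universal (λ _ → refl) (varsQ q))
  ... | posPs , posE =
    to (equation-transfer A e posE)
      (hD (inj₁ ∘ σ) (++⁺ (map⁺ (from (premisses-transfer A posPs) prem))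
                          (map⁺ {f = negPremiss} (All.universal (positive⇒negation-fixed A ∘ σ) (varsQ q)))))
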